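{- Let $F=(n_F)_{n\ge1}$ be a sequence in $\mathcal{T}_\lambda$. Let $n\in\mathbb{N}$, and let $(b_1,\dots,b_k)$ be any composition of $n$ into $k$ positive parts, so $b_1+\cdots+b_k=n$. Then the $F$-box $V_n=[1_F]\times[2_F]\times\cdots\times[n_F]$ can be partitioned into pairwise disjoint multi-blocks of the form $\sigma P_{b_1,\dots,b_k}$. Equivalently, the set of maximal paths of the cobweb layer $\langle\Phi_1\to\Phi_n\rangle$ can be so partitioned.
   Context: Here $\mathbb{N}=\{1,2,\dots\}$. The family $\mathcal{T}_\lambda$ consists of all sequences $F=(n_F)_{n\ge1}$ of positive integers for which there are coefficients $\lambda_K(k,m),\lambda_M(k,m)\in\mathbb{N}\cup\{0\}$ satisfying $(k+m)_F=\lambda_K(k,m)\,k_F+\lambda_M(k,m)\,m_F$ for all $k,m\in\mathbb{N}$. Write $[s_F]=\{1,\dots,s_F\}$. Given the composition $(b_1,\dots,b_k)$, let $L=(L_1,\dots,L_n)=(1,2,\dots,b_1,\,1,2,\dots,b_2,\,\dots,\,1,2,\dots,b_k)$. A multi-block of the form $\sigma P_{b_1,\dots,b_k}$ is a set $A_1\times\cdots\times A_n$ such that $A_s\subseteq[s_F]$ and $|A_s|=(L_{\sigma(s)})_F$ for $s=1,\dots,n$, where $\sigma$ is some permutation of $\{1,\dots,n\}$. Different multi-blocks in the partition may use different permutations $\sigma$. In cobweb language, points of the box correspond to maximal paths $(v_1,\dots,v_n)$, $v_s\in\Phi_s=\{1,\dots,s_F\}$, of the layer $\langle\Phi_1\to\Phi_n\rangle$.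 -}

module Defs where

open import Data.Nat using (ℕ; zero; suc; _+_; _*_; _≤_)
open import Data.Fin using (Fin; toℕ)
open import Data.Fin.Subset using (Subset; _∈_; ∣_∣)
open import Data.Fin.Permutation using (Permutation′; _⟨$⟩ʳ_)
open import Data.List using (List; []; _∷_; map; concatMap; upTo)
open import Data.Product using (Σ; ∃; _×_)
open import Relation.Binary.PropositionalEquality using (_≡_)

-- A sequence F = (n_F)_{n ≥ 1} is modelled as F : ℕ → ℕ, where n_F = F n
-- for n ≥ 1 (the value F 0 is irrelevant and never used).

Positive : (ℕ → ℕ) → Set
Positive F = ∀ n → 1 ≤ F (suc n)

InTλ : (ℕ → ℕ) → Set
InTλ F = Positive F ×
  Σ (ℕ → ℕ → ℕ) λ λK → Σ (ℕ → ℕ → ℕ) λ λM →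
    ∀ k m → F (suc k + suc m) ≡ λK (suc k) (suc m) * F (suc k) + λM (suc k) (suc m) * F (suc m)

Lseq : List ℕ → List ℕ
Lseq bs = concatMap (λ b → map suc (upTo b)) bs

-- 0-based lookup with default 0 (only used at indices < length, so the
-- default never matters when sumL bs ≡ n)
nth : List ℕ → ℕ → ℕ
nth [] _ = 0
nth (x ∷ xs) zero = x
nth (x ∷ xs) (suc i) = nth xs i

-- The F-box V_n = [1_F] × ⋯ × [n_F]; coordinate s : Fin n stands for
-- position s+1, with values in Fin ((s+1)_F) ≅ [ (s+1)_F ].
Box : (ℕ → ℕ) → ℕ → Set
Box F n = (s : Fin n) → Fin (F (suc (toℕ s)))

-- A multi-block of the form σ P_{b₁,…,b_k}: a permutation σ of the n
-- positions and subsets A_s ⊆ [s_F] with |A_s| = (L_{σ(s)})_F.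
record MultiBlock (F : ℕ → ℕ) (n : ℕ) (bs : List ℕ) : Set where
  field
    σ    : Permutation′ n
    A    : (s : Fin n) → Subset (F (suc (toℕ s)))
    size : ∀ s → ∣ A s ∣ ≡ F (nth (Lseq bs) (toℕ (σ ⟨$⟩ʳ s)))

_∈MB_ : ∀ {F n bs} → Box F n → MultiBlock F n bs → Set
x ∈MB B = ∀ s → x s ∈ MultiBlock.A B s

IsPartition : ∀ {F n bs} (m : ℕ) → (Fin m → MultiBlock F n bs) → Set
IsPartition {F} {n} m blocks =
  (∀ (x : Box F n) → ∃ λ i → x ∈MB blocks i) ×
  (∀ (x : Box F n) (i j : Fin m) → x ∈MB blocks i → x ∈MB blocks j → i ≡ j)

-- Applying the T_λ recurrence to b₁ + (b₂ + ⋯ + b_k) repeatedly writes n_F as a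
-- sum of terms (b_i)_F with multiplicities, so the last side [n_F] splits into consecutive
-- intervals of these sizes. An interval of size (b_i)_F goes with block permutations sending
-- position n to the last entry b_i of the i-th run 1, …, b_i of L. Deleting that entry from L
-- leaves the L of the composition of n − 1 with b_i lowered by one, for which V_{n−1} is
-- partitioned into multi-blocks by induction; the products of these blocks with the interval,
-- over all intervals, partition V_n.
module Submission where

open import Defs
open import Data.Nat using (ℕ; zero; suc; pred; _+_; _*_; _<_; _≤_; z≤n; s≤s)
open import Data.Nat.Properties using (suc-injective; +-identityʳ; +-suc)
open import Data.Nat.ListAction using (sum)
open import Data.Nat.ListAction.Properties using (sum-++)
open import Data.List using (List; []; _∷_; _++_; [_]; length; map; concat; replicate; applyUpTo; upTo; lookup; tabulate; _[_]%=_)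
open import Data.List.Properties using (length-++; length-map; length-upTo; map-++; map-∘; map-tabulate; tabulate-lookup)
open import Data.List.Relation.Unary.All using (All)
open import Data.Fin using (Fin; zero; suc; toℕ; fromℕ; fromℕ<; inject₁; punchIn; _↑ˡ_; _↑ʳ_)
open import Data.Fin.Properties using (toℕ-fromℕ; toℕ-inject₁; toℕ-fromℕ<; +↔⊎; _≟_)
open import Data.Fin.Subset using (Subset; _∈_; _∉_; ∣_∣; ⊤; ⊥)
open import Data.Fin.Subset.Properties using (∈⊤; ∉⊥; ∣⊤∣≡n; ∣⊥∣≡0)
open import Data.Fin.Permutation using (Permutation; Permutation′; _⟨$⟩ʳ_; insert; insert-punchIn)
import Data.Fin.Permutation as Permutation
import Data.Vec as Vec
open import Data.Vec.Properties using ([]=⇒lookup; lookup⇒[]=; lookup-++ˡ; lookup-++ʳ)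
open import Data.Bool using (true; false)
open import Data.Sum using (_⊎_; inj₁; inj₂)
open import Data.Product using (Σ; ∃; _×_; _,_; proj₁; proj₂)
open import Function using (_∘_; id; _↔_; Inverse; Injection; mk↔ₛ′; _⇔_; mk⇔; Equivalence)
open import Function.Construct.Composition using (_↔-∘_)
open import Function.Construct.Identity using (↔-id)
open import Function.Construct.Symmetry using (↔-sym)
open import Function.Properties.Inverse using (↔⇒↣)
open import Data.Sum.Function.Propositional using (_⊎-↔_)
open import Relation.Nullary using (yes; no; contradiction)
open import Relation.Binary.PropositionalEquality using (_≡_; refl; sym; trans; cong; cong₂; subst; module ≡-Reasoning)

Partition : (X : Set) {I : Set} → (I → X → Set) → Set
Partition X {I} P = (∀ x → ∃ λ i → P i x) × (∀ x i j → P i x → P j x → i ≡ j)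

module _ {X I : Set} {P : I → X → Set} where

  Partition-reindex : ∀ {J : Set} (e : J ↔ I) → Partition X P → Partition X (P ∘ Inverse.to e)
  Partition-reindex e (cover , disjoint) = cover′ , disjoint′
    where
    open Inverse e using (to; from; strictlyInverseˡ)
    cover′ : ∀ x → ∃ λ j → P (to j) x
    cover′ x = from (proj₁ (cover x)) , subst (λ i → P i x) (sym (strictlyInverseˡ _)) (proj₂ (cover x))
    disjoint′ : ∀ x j k → P (to j) x → P (to k) x → j ≡ k
    disjoint′ x j k h h′ = Injection.injective (↔⇒↣ e) (disjoint x _ _ h h′)

  Partition-pullback : ∀ {Z : Set} {Q : I → Z → Set} (g : Z → X) →
    (∀ i z → Q i z ⇔ P i (g z)) → Partition X P → Partition Z Q
  Partition-pullback g Q⇔P (cover , disjoint) =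
    (λ z → proj₁ (cover (g z)) , Equivalence.from (Q⇔P _ z) (proj₂ (cover (g z)))) ,
    (λ z i j h h′ → disjoint (g z) i j (Equivalence.to (Q⇔P i z) h) (Equivalence.to (Q⇔P j z) h′))

Partition-× : ∀ {X Y J : Set} {I : J → Set} {P : J → Y → Set} {Q : (j : J) → I j → X → Set} →
  Partition Y P → (∀ j → Partition X (Q j)) →
  Partition (X × Y) {Σ J I} (λ (j , i) (x , y) → Q j i x × P j y)
Partition-× {X} {Y} {J} {I} {P} {Q} (coverY , disjointY) partX = cover , disjoint
  where
  cover : ∀ ((x , y) : X × Y) → ∃ λ ((j , i) : Σ J I) → Q j i x × P j y
  cover (x , y) with coverY y
  ... | j , y∈j with proj₁ (partX j) x
  ...   | i , x∈i = (j , i) , x∈i , y∈j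
  disjoint : ∀ ((x , y) : X × Y) ((j , i) (j′ , i′) : Σ J I) →
    Q j i x × P j y → Q j′ i′ x × P j′ y → (j , i) ≡ (j′ , i′)
  disjoint (x , y) (j , i) (j′ , i′) (x∈i , y∈j) (x∈i′ , y∈j′) with disjointY y j j′ y∈j y∈j′
  ... | refl = cong (j ,_) (proj₂ (partX j) x i i′ x∈i x∈i′)

Σ-Fin-suc↔⊎ : ∀ {q} {A : Fin (suc q) → Set} → Σ (Fin (suc q)) A ↔ (A zero ⊎ Σ (Fin q) (A ∘ suc))
Σ-Fin-suc↔⊎ {q} {A} = mk↔ₛ′ to from to-from from-to
  where
  to : Σ (Fin (suc q)) A → A zero ⊎ Σ (Fin q) (A ∘ suc)
  to (zero , a) = inj₁ a
  to (suc j , a) = inj₂ (j , a)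
  from : A zero ⊎ Σ (Fin q) (A ∘ suc) → Σ (Fin (suc q)) A
  from (inj₁ a) = zero , a
  from (inj₂ (j , a)) = suc j , a
  to-from : ∀ y → to (from y) ≡ y
  to-from (inj₁ a) = refl
  to-from (inj₂ (j , a)) = refl
  from-to : ∀ x → from (to x) ≡ x
  from-to (zero , a) = refl
  from-to (suc j , a) = refl

sum↔Σ : ∀ {q} (m : Fin q → ℕ) → Fin (sum (tabulate m)) ↔ Σ (Fin q) (Fin ∘ m)
sum↔Σ {zero} m = mk↔ₛ′ (λ ()) (λ { (() , _) }) (λ { (() , _) }) (λ ())
sum↔Σ {suc q} m = ↔-sym Σ-Fin-suc↔⊎ ↔-∘ ((↔-id _ ⊎-↔ sum↔Σ (m ∘ suc)) ↔-∘ +↔⊎)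

data Split (m n : ℕ) : Fin (m + n) → Set where
  left  : (a : Fin m) → Split m n (a ↑ˡ n)
  right : (b : Fin n) → Split m n (m ↑ʳ b)

split : ∀ m {n} (y : Fin (m + n)) → Split m n y
split zero y = right y
split (suc m) zero = left zero
split (suc m) (suc y) with split m y
... | left a = left (suc a)
... | right b = right b

∈-resp-lookup : ∀ {m n} {p : Subset m} {q : Subset n} {a b} →
  Vec.lookup p a ≡ Vec.lookup q b → a ∈ p ⇔ b ∈ q
∈-resp-lookup eq =
  mk⇔ (λ h → lookup⇒[]= _ _ (trans (sym eq) ([]=⇒lookup h)))
      (λ h → lookup⇒[]= _ _ (trans eq ([]=⇒lookup h)))

∣p++q∣≡∣p∣+∣q∣ : ∀ {m n} (p : Subset m) (q : Subset n) → ∣ p Vec.++ q ∣ ≡ ∣ p ∣ + ∣ q ∣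
∣p++q∣≡∣p∣+∣q∣ Vec.[] q = refl
∣p++q∣≡∣p∣+∣q∣ (true Vec.∷ p) q = cong suc (∣p++q∣≡∣p∣+∣q∣ p q)
∣p++q∣≡∣p∣+∣q∣ (false Vec.∷ p) q = ∣p++q∣≡∣p∣+∣q∣ p q

↑ˡ∈++⇔ : ∀ {m n} (p : Subset m) (q : Subset n) a → a ↑ˡ n ∈ p Vec.++ q ⇔ a ∈ p
↑ˡ∈++⇔ p q a = ∈-resp-lookup (lookup-++ˡ p q a)

↑ʳ∈++⇔ : ∀ {m n} (p : Subset m) (q : Subset n) b → m ↑ʳ b ∈ p Vec.++ q ⇔ b ∈ q
↑ʳ∈++⇔ p q b = ∈-resp-lookup (lookup-++ʳ p q b)

record SubsetPartition (N : ℕ) {q : ℕ} (w : Fin q → ℕ) : Set where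
  field
    subset    : Fin q → Subset N
    size      : ∀ j → ∣ subset j ∣ ≡ w j
    partition : Partition (Fin N) (λ j y → y ∈ subset j)

intervals : ∀ {q} (w : Fin q → ℕ) → SubsetPartition (sum (tabulate w)) w
intervals {zero} w = record { subset = λ () ; size = λ () ; partition = (λ ()) , λ () }
intervals {suc q} w = record { subset = P ; size = size ; partition = cover , disjoint }
  where
  open SubsetPartition (intervals (w ∘ suc)) renaming (subset to P′; size to size′; partition to partition′)
  N′ : ℕ
  N′ = sum (tabulate (w ∘ suc))
  ⊤₀ ⊥₀ : Subset (w zero)
  ⊤₀ = ⊤
  ⊥₀ = ⊥
  ⊥′ : Subset N′
  ⊥′ = ⊥
  P : Fin (suc q) → Subset (w zero + N′)
  P zero = ⊤₀ Vec.++ ⊥′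
  P (suc j) = ⊥₀ Vec.++ P′ j
  size : ∀ j → ∣ P j ∣ ≡ w j
  size zero = trans (∣p++q∣≡∣p∣+∣q∣ ⊤₀ ⊥′)
    (trans (cong₂ _+_ (∣⊤∣≡n (w zero)) (∣⊥∣≡0 N′)) (+-identityʳ (w zero)))
  size (suc j) = trans (∣p++q∣≡∣p∣+∣q∣ ⊥₀ (P′ j)) (cong₂ _+_ (∣⊥∣≡0 (w zero)) (size′ j))
  left∉ : ∀ {j} a → a ↑ˡ N′ ∉ P (suc j)
  left∉ {j} a = ∉⊥ ∘ Equivalence.to (↑ˡ∈++⇔ ⊥₀ (P′ j) a)
  right∉ : ∀ b → w zero ↑ʳ b ∉ P zero
  right∉ b = ∉⊥ ∘ Equivalence.to (↑ʳ∈++⇔ ⊤₀ ⊥′ b)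
  cover : ∀ y → ∃ λ j → y ∈ P j
  cover y with split (w zero) y
  ... | left a = zero , Equivalence.from (↑ˡ∈++⇔ ⊤₀ ⊥′ a) ∈⊤
  ... | right b with proj₁ partition′ b
  ...   | j , b∈P′j = suc j , Equivalence.from (↑ʳ∈++⇔ ⊥₀ (P′ j) b) b∈P′j
  disjoint-split : ∀ {y} → Split (w zero) N′ y → ∀ j k → y ∈ P j → y ∈ P k → j ≡ k
  disjoint-split (left a) zero zero _ _ = refl
  disjoint-split (left a) (suc j) k h _ = contradiction h (left∉ a)
  disjoint-split (left a) zero (suc k) _ h = contradiction h (left∉ a)
  disjoint-split (right b) zero k h _ = contradiction h (right∉ b)
  disjoint-split (right b) (suc j) zero _ h = contradiction h (right∉ b)
  disjoint-split (right b) (suc j) (suc k) h h′ = cong suc (proj₂ partition′ b j k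
    (Equivalence.to (↑ʳ∈++⇔ ⊥₀ (P′ j) b) h) (Equivalence.to (↑ʳ∈++⇔ ⊥₀ (P′ k) b) h′))
  disjoint : ∀ y j k → y ∈ P j → y ∈ P k → j ≡ k
  disjoint y = disjoint-split (split (w zero) y)

data Delete : List ℕ → ℕ → ℕ → List ℕ → Set where
  here  : ∀ {v xs} → Delete (v ∷ xs) 0 v xs
  there : ∀ {x xs p v ys} → Delete xs p v ys → Delete (x ∷ xs) (suc p) v (x ∷ ys)

Delete⇒nth : ∀ {xs p v ys} → Delete xs p v ys → nth xs p ≡ v
Delete⇒nth here = refl
Delete⇒nth (there del) = Delete⇒nth del

Delete⇒< : ∀ {xs p v ys} → Delete xs p v ys → p < length xs
Delete⇒< here = s≤s z≤n
Delete⇒< (there del) = s≤s (Delete⇒< del)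

Delete⇒nth-punchIn : ∀ {xs p v ys} → Delete xs p v ys → ∀ {n} (i : Fin (suc n)) → toℕ i ≡ p →
  ∀ k → nth xs (toℕ (punchIn i k)) ≡ nth ys (toℕ k)
Delete⇒nth-punchIn here zero _ k = refl
Delete⇒nth-punchIn (there del) (suc i) i≡p zero = refl
Delete⇒nth-punchIn (there del) (suc i) i≡p (suc k) = Delete⇒nth-punchIn del i (suc-injective i≡p) k

Delete-++ˡ : ∀ zs {xs p v ys} → Delete xs p v ys → Delete (zs ++ xs) (length zs + p) v (zs ++ ys)
Delete-++ˡ [] del = del
Delete-++ˡ (z ∷ zs) del = there (Delete-++ˡ zs del)

Delete-last : ∀ (f : ℕ → ℕ) d zs →
  Delete (map suc (applyUpTo f (suc d)) ++ zs) d (suc (f d)) (map suc (applyUpTo f d) ++ zs)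
Delete-last f zero zs = here
Delete-last f (suc d) zs = there (Delete-last (f ∘ suc) d zs)

length-Lseq : ∀ c → length (Lseq c) ≡ sum c
length-Lseq [] = refl
length-Lseq (b ∷ c) = trans (length-++ (map suc (upTo b)))
  (cong₂ _+_ (trans (length-map suc (upTo b)) (length-upTo b)) (length-Lseq c))

Delete-Lseq : ∀ c i {d} → lookup c i ≡ suc d → ∃ λ p → Delete (Lseq c) p (suc d) (Lseq (c [ i ]%= pred))
Delete-Lseq (b ∷ c) zero {d} refl = d , Delete-last id d (Lseq c)
Delete-Lseq (b ∷ c) (suc i) c[i]≡1+d with Delete-Lseq c i c[i]≡1+d
... | p , del = length (map suc (upTo b)) + p , Delete-++ˡ (map suc (upTo b)) del

sum-decrement : ∀ c i {d} → lookup c i ≡ suc d → sum c ≡ suc (sum (c [ i ]%= pred))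
sum-decrement (b ∷ c) zero refl = refl
sum-decrement (b ∷ c) (suc i) c[i]≡1+d = trans (cong (b +_) (sum-decrement c i c[i]≡1+d)) (+-suc b _)

data InitOrLast {n : ℕ} : Fin (suc n) → Set where
  init : (s : Fin n) → InitOrLast (inject₁ s)
  last : InitOrLast (fromℕ n)

initOrLast : ∀ {n} (s : Fin (suc n)) → InitOrLast s
initOrLast {zero} zero = last
initOrLast {suc n} zero = init zero
initOrLast {suc n} (suc s) with initOrLast s
... | init t = init (suc t)
... | last = last

initOrLast-inject₁ : ∀ {n} (s : Fin n) → initOrLast (inject₁ s) ≡ init s
initOrLast-inject₁ {suc n} zero = refl
initOrLast-inject₁ {suc n} (suc s) rewrite initOrLast-inject₁ s = refl

initOrLast-fromℕ : ∀ n → initOrLast (fromℕ n) ≡ last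
initOrLast-fromℕ zero = refl
initOrLast-fromℕ (suc n) rewrite initOrLast-fromℕ n = refl

punchIn-fromℕ : ∀ {n} (s : Fin n) → punchIn (fromℕ n) s ≡ inject₁ s
punchIn-fromℕ zero = refl
punchIn-fromℕ (suc s) = cong suc (punchIn-fromℕ s)

insert-self : ∀ {m n} (i : Fin (suc m)) (j : Fin (suc n)) (π : Permutation m n) → insert i j π ⟨$⟩ʳ i ≡ j
insert-self i j π with i ≟ i
... | yes _ = refl
... | no i≢i = contradiction refl i≢i

FinBox : ∀ {n} → (Fin n → ℕ) → Set
FinBox {n} D = (s : Fin n) → Fin (D s)

-- MultiBlock F n c is the case D s = (s+1)_F. Arbitrary side lengths D let the first n coordinates
-- of a point of a box of dimension n + 1 form a point of a box again, without casts.
record Block (F : ℕ → ℕ) {n : ℕ} (D : Fin n → ℕ) (c : List ℕ) : Set where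
  field
    σ    : Permutation′ n
    A    : (s : Fin n) → Subset (D s)
    size : ∀ s → ∣ A s ∣ ≡ F (nth (Lseq c) (toℕ (σ ⟨$⟩ʳ s)))

_∈B_ : ∀ {F n} {D : Fin n → ℕ} {c} → FinBox D → Block F D c → Set
x ∈B B = ∀ s → x s ∈ Block.A B s

module Extension (F : ℕ → ℕ) {n p v : ℕ} (D : Fin (suc n) → ℕ) (c c′ : List ℕ)
    (del : Delete (Lseq c) p v (Lseq c′)) (p<1+n : p < suc n)
    (P : Subset (D (fromℕ n))) (∣P∣≡Fv : ∣ P ∣ ≡ F v) (B : Block F (D ∘ inject₁) c′) where

  -- The last coordinate goes to the deleted position p, the others around it as under B.
  σ : Permutation′ (suc n)
  σ = insert (fromℕ n) (fromℕ< p<1+n) (Block.σ B)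

  A : ∀ {s} → InitOrLast s → Subset (D s)
  A (init s) = Block.A B s
  A last = P

  size : ∀ {s} (w : InitOrLast s) → ∣ A w ∣ ≡ F (nth (Lseq c) (toℕ (σ ⟨$⟩ʳ s)))
  size (init s) = trans (Block.size B s) (cong F (sym (begin
    nth (Lseq c) (toℕ (σ ⟨$⟩ʳ inject₁ s))
      ≡⟨ cong (λ t → nth (Lseq c) (toℕ (σ ⟨$⟩ʳ t))) (sym (punchIn-fromℕ s)) ⟩
    nth (Lseq c) (toℕ (σ ⟨$⟩ʳ punchIn (fromℕ n) s))
      ≡⟨ cong (nth (Lseq c) ∘ toℕ) (insert-punchIn (fromℕ n) (fromℕ< p<1+n) (Block.σ B) s) ⟩
    nth (Lseq c) (toℕ (punchIn (fromℕ< p<1+n) (Block.σ B ⟨$⟩ʳ s)))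
      ≡⟨ Delete⇒nth-punchIn del (fromℕ< p<1+n) (toℕ-fromℕ< p<1+n) (Block.σ B ⟨$⟩ʳ s) ⟩
    nth (Lseq c′) (toℕ (Block.σ B ⟨$⟩ʳ s)) ∎)))
    where open ≡-Reasoning
  size last = trans ∣P∣≡Fv (cong F (sym (begin
    nth (Lseq c) (toℕ (σ ⟨$⟩ʳ fromℕ n))
      ≡⟨ cong (nth (Lseq c) ∘ toℕ) (insert-self (fromℕ n) (fromℕ< p<1+n) (Block.σ B)) ⟩
    nth (Lseq c) (toℕ (fromℕ< p<1+n))   ≡⟨ cong (nth (Lseq c)) (toℕ-fromℕ< p<1+n) ⟩
    nth (Lseq c) p                      ≡⟨ Delete⇒nth del ⟩
    v                                   ∎)))
    where open ≡-Reasoning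

  block : Block F D c
  block = record { σ = σ ; A = λ s → A (initOrLast s) ; size = λ s → size (initOrLast s) }

  ∈-block⇔ : ∀ x → x ∈B block ⇔ ((λ s → x (inject₁ s)) ∈B B × x (fromℕ n) ∈ P)
  ∈-block⇔ x = mk⇔ to from
    where
    to : x ∈B block → (λ s → x (inject₁ s)) ∈B B × x (fromℕ n) ∈ P
    to x∈ = (λ s → subst (λ w → x (inject₁ s) ∈ A w) (initOrLast-inject₁ s) (x∈ (inject₁ s))) ,
            subst (λ w → x (fromℕ n) ∈ A w) (initOrLast-fromℕ n) (x∈ (fromℕ n))
    from : (λ s → x (inject₁ s)) ∈B B × x (fromℕ n) ∈ P → x ∈B block
    from (x∈B , x∈P) s = go (initOrLast s)
      where
      go : ∀ {s} (w : InitOrLast s) → x s ∈ A w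
      go (init s) = x∈B s
      go last = x∈P

-- The i-th run 1, …, d+1 of Lseq c (runs are indexed by the parts of c).
record Run (c : List ℕ) : Set where
  constructor run
  field
    i        : Fin (length c)
    d        : ℕ
    c[i]≡1+d : lookup c i ≡ suc d

  shortened : List ℕ
  shortened = c [ i ]%= pred

  sum-shortened : sum c ≡ suc (sum shortened)
  sum-shortened = sum-decrement c i c[i]≡1+d

  deletion : ∃ λ p → Delete (Lseq c) p (suc d) (Lseq shortened)
  deletion = Delete-Lseq c i c[i]≡1+d

shift : ∀ {b c} → Run c → Run (b ∷ c)
shift (run i d c[i]≡1+d) = run (suc i) d c[i]≡1+d

sum-map-++ : ∀ {A : Set} (f : A → ℕ) xs ys → sum (map f (xs ++ ys)) ≡ sum (map f xs) + sum (map f ys)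
sum-map-++ f xs ys = trans (cong sum (map-++ f xs ys)) (sum-++ (map f xs) (map f ys))

sum-map-copies : ∀ {A : Set} (f : A → ℕ) k xs → sum (map f (concat (replicate k xs))) ≡ k * sum (map f xs)
sum-map-copies f zero xs = refl
sum-map-copies f (suc k) xs =
  trans (sum-map-++ f xs (concat (replicate k xs))) (cong (sum (map f xs) +_) (sum-map-copies f k xs))

module _ (F : ℕ → ℕ)
  (combination : ∀ k m → Σ ℕ λ a → Σ ℕ λ b → F (suc k + suc m) ≡ a * F (suc k) + b * F (suc m)) where

  weight : ∀ {c} → Run c → ℕ
  weight r = F (suc (Run.d r))

  F≡sum-runs : ∀ {n} c → sum c ≡ suc n → Σ (List (Run c)) λ rs → F (suc n) ≡ sum (map weight rs)
  F≡sum-runs (zero ∷ c) sum≡ with F≡sum-runs c sum≡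
  ... | rs , eq = map shift rs , trans eq (cong sum (map-∘ rs))
  F≡sum-runs {n} (suc d ∷ c) sum≡ with sum c in sum-c≡
  ... | zero = [ run zero d refl ] ,
    trans (cong F (trans (sym sum≡) (+-identityʳ (suc d)))) (sym (+-identityʳ (F (suc d))))
  ... | suc m with F≡sum-runs c sum-c≡ | combination d m
  ...   | rs , eq | a , b , F≡ = copies a [ r₀ ] ++ copies b (map shift rs) , (begin
    F (suc n)                                    ≡⟨ cong F (sym sum≡) ⟩
    F (suc d + suc m)                            ≡⟨ F≡ ⟩
    a * F (suc d) + b * F (suc m)                ≡⟨ cong₂ _+_ (cong (a *_) (sym (+-identityʳ (F (suc d)))))
                                                             (cong (b *_) (trans eq (cong sum (map-∘ rs)))) ⟩
    a * sum (map weight [ r₀ ]) + b * sum (map weight (map shift rs))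
      ≡⟨ sym (cong₂ _+_ (sum-map-copies weight a [ r₀ ]) (sum-map-copies weight b (map shift rs))) ⟩
    sum (map weight (copies a [ r₀ ])) + sum (map weight (copies b (map shift rs)))
      ≡⟨ sym (sum-map-++ weight (copies a [ r₀ ]) _) ⟩
    sum (map weight (copies a [ r₀ ] ++ copies b (map shift rs))) ∎)
    where
    open ≡-Reasoning
    copies : ∀ {A : Set} → ℕ → List A → List A
    copies k xs = concat (replicate k xs)
    r₀ : Run (suc d ∷ c)
    r₀ = run zero d refl

  record BlockPartition {n : ℕ} (D : Fin n → ℕ) (c : List ℕ) : Set where
    field
      count     : ℕ
      blocks    : Fin count → Block F D c
      partition : Partition (FinBox D) (λ i x → x ∈B blocks i)

  block-partition : ∀ n (D : Fin n → ℕ) → (∀ s → D s ≡ F (suc (toℕ s))) →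
    ∀ c → sum c ≡ n → BlockPartition D c
  block-partition zero D _ c _ = record
    { count = 1
    ; blocks = λ _ → record { σ = Permutation.id ; A = λ () ; size = λ () }
    ; partition = (λ x → zero , λ ()) , λ { x zero zero _ _ → refl }
    }
  block-partition (suc n) D D≡F c sum≡ = record
    { count = sum (tabulate count)
    ; blocks = block ∘ Inverse.to (sum↔Σ count)
    ; partition = Partition-reindex (sum↔Σ count)
        (Partition-pullback (λ x → (λ s → x (inject₁ s)) , x (fromℕ n)) (λ (j , b) → Ext.∈-block⇔ j b)
          (Partition-× last-partition (λ j → BlockPartition.partition (init-partition j))))
    }
    where
    rs : List (Run c)
    rs = proj₁ (F≡sum-runs c sum≡)
    r : Fin (length rs) → Run c
    r = lookup rs
    D-last : D (fromℕ n) ≡ sum (tabulate (weight ∘ r))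
    D-last = begin
      D (fromℕ n)                       ≡⟨ trans (D≡F (fromℕ n)) (cong (F ∘ suc) (toℕ-fromℕ n)) ⟩
      F (suc n)                         ≡⟨ proj₂ (F≡sum-runs c sum≡) ⟩
      sum (map weight rs)               ≡⟨ cong (sum ∘ map weight) (sym (tabulate-lookup rs)) ⟩
      sum (map weight (tabulate r))     ≡⟨ cong sum (map-tabulate r weight) ⟩
      sum (tabulate (weight ∘ r))       ∎
      where open ≡-Reasoning
    open SubsetPartition (subst (λ N → SubsetPartition N (weight ∘ r)) (sym D-last) (intervals (weight ∘ r)))
      renaming (partition to last-partition)
    init-partition : ∀ j → BlockPartition (D ∘ inject₁) (Run.shortened (r j))
    init-partition j = block-partition n (D ∘ inject₁)
      (λ s → trans (D≡F (inject₁ s)) (cong (F ∘ suc) (toℕ-inject₁ s))) (Run.shortened (r j)) (suc-injective (trans (sym (Run.sum-shortened (r j))) sum≡))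
    count : Fin (length rs) → ℕ
    count j = BlockPartition.count (init-partition j)
    position< : ∀ j → proj₁ (Run.deletion (r j)) < suc n
    position< j = subst (proj₁ (Run.deletion (r j)) <_) (trans (length-Lseq c) sum≡)
      (Delete⇒< (proj₂ (Run.deletion (r j))))
    module Ext (j : Fin (length rs)) (b : Fin (count j)) = Extension F D c (Run.shortened (r j))
      (proj₂ (Run.deletion (r j))) (position< j) (subset j) (size j) (BlockPartition.blocks (init-partition j) b)
    block : Σ (Fin (length rs)) (Fin ∘ count) → Block F D c
    block (j , b) = Ext.block j b

theorem2 : (F : ℕ → ℕ) → InTλ F → (n : ℕ) → 1 ≤ n →
    (bs : List ℕ) → All (1 ≤_) bs → sum bs ≡ n →
    Σ ℕ λ m → Σ (Fin m → MultiBlock F n bs) λ blocks → IsPartition m blocks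
theorem2 F (_ , λK , λM , F≡) n _ bs _ sum≡ = count , (λ i → record { Block (blocks i) }) , partition
  where
  open BlockPartition (block-partition F (λ k m → λK (suc k) (suc m) , λM (suc k) (suc m) , F≡ k m)
    n (λ s → F (suc (toℕ s))) (λ _ → refl) bs sum≡)
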